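{- Let $G=(V,E,l,u,S,T,d,c)$ be a planar interdiction network with $-d(S)=d(T)$, and let $\widehat{G}=(V,\widehat{E}=E\cup\mathcal{T},\widehat{l},\widehat{u},\widehat{c})$ be the auxiliary network constructed from a tree $\mathcal{T}'$ as described in the context. Then for every interdiction set $R\subset V\cup E$ of $G$: there is a saturating flow in $G\setminus R$ if and only if there is a circulation in $\widehat{G}(R)$.
   Context: $G=(V,E,l,u,S,T,d,c)$: directed planar graph $(V,E)$ with lower and upper arc capacities $l(e)\le u(e)$ in $\{0,1,2,\dots\}$, disjoint source set $S$ and sink set $T$, integral supply/demand $d$ with $d(s)<0$ for $s\in S$, $d(t)>0$ for $t\in T$, $d(v)=0$ otherwise, and $d(S)=\sum_{s\in S}d(s)$, $d(T)=\sum_{t\in T}d(t)$; interdiction costs $c(p)\in\{1,2,\dots\}\cup\{\infty\}$ for $p\in V\cup E$, with $c=\infty$ on $S\cup T$. An interdiction set is $R\subset V\cup E$ with $c(R)\le B$ for a given budget $B$. $G\setminus R$ is obtained by deleting the arcs of $R$ and the vertices of $R$ with all incident arcs. A saturating flow is $f$ with $l\le f\le u$, net outflow $-d(s)$ at each source, net inflow $d(t)$ at each sink and conservation elsewhere. A circulation in a network with lower/upper capacities is $f$ with $l\le f\le u$ and conservation at every vertex. Construction of $\widehat{G}$: let $\mathcal{T}'$ be an undirected tree on vertices of $V$ spanning $S\cup T$ that can be added to $G$ without destroying planarity. For an edge $\{v,w\}$ of $\mathcal{T}'$ let $V_{\mathcal{T}'}(v,w)$ be the set of vertices connected to $v$ in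 $\mathcal{T}'\setminus\{v,w\}$. Orient $\{v,w\}$ from $v$ to $w$ if $d(V_{\mathcal{T}'}(v,w))\ge 0$ and from $w$ to $v$ otherwise; the resulting arc set is $\mathcal{T}$. Set $\widehat{E}=E\cup\mathcal{T}$, $\widehat{l},\widehat{u}$ extend $l,u$ with $\widehat{l}(v,w)=\widehat{u}(v,w)=d(V_{\mathcal{T}'}(v,w))$ for $(v,w)\in\mathcal{T}$, and $\widehat{c}$ extends $c$ with $\widehat{c}=\infty$ on $\mathcal{T}$. For $R\subset V\cup E$, $\widehat{G}(R)$ is obtained from $\widehat{G}$ by removing all arcs in $R$ and all arcs of $E$ incident to a vertex in $R$ (arcs of $\mathcal{T}$ are kept). -}

module Defs where

open import Data.Nat as ℕ using (ℕ; zero; suc)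
open import Data.Integer as ℤ using (ℤ; 0ℤ; +_)
open import Data.Fin as Fin using (Fin; zero; suc; splitAt)
open import Data.Bool using (Bool; true; false; if_then_else_; not; _∧_; _∨_)
open import Data.Maybe using (Maybe; just; nothing)
open import Data.Product using (Σ; ∃; _×_; _,_)
open import Data.Sum using ([_,_]′)
open import Relation.Binary.PropositionalEquality using (_≡_)
open import Relation.Nullary using (¬_; does)
open import Function using (_∘_)
open import Function.Bundles using (_⇔_)
open import Data.Unit using (⊤)

∑ : ∀ {m} → (Fin m → ℤ) → ℤ
∑ {zero}  f = 0ℤ
∑ {suc m} f = f zero ℤ.+ ∑ (f ∘ suc)

mask : Bool → ℤ → ℤ
mask b x = if b then x else 0ℤ

_==_ : ∀ {n} → Fin n → Fin n → Bool
x == y = does (x Fin.≟ y)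

iter : ∀ {A : Set} → (A → A) → ℕ → A → A
iter p zero    x = x
iter p (suc k) x = p (iter p k x)

HasClasses : {A : Set} → (A → A → Set) → ℕ → Set
HasClasses {A} R k =
  Σ (A → Fin k) λ cls →
    (∀ i → ∃ λ x → cls x ≡ i) ×
    (∀ x y → cls x ≡ cls y → R x y) ×
    (∀ x y → R x y → cls x ≡ cls y)

-- forward orbit relation of a map (an equivalence for a permutation of a finite set)
SameOrbit : {A : Set} → (A → A) → A → A → Set
SameOrbit p x y = ∃ λ k → iter p k x ≡ y

-- orbit relation of the group generated by two permutations p, q of a finite set
data Orbit₂ {A : Set} (p q : A → A) : A → A → Set where
  here : ∀ {x} → Orbit₂ p q x x
  viaP : ∀ {x y} → Orbit₂ p q (p x) y → Orbit₂ p q x y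
  viaQ : ∀ {x y} → Orbit₂ p q (q x) y → Orbit₂ p q x y

record UGraph (n m : ℕ) : Set where
  field
    end₀ end₁ : Fin m → Fin n

Dart : ℕ → Set
Dart m = Fin m × Bool

flipDart : ∀ {m} → Dart m → Dart m
flipDart (e , b) = (e , not b)

dartVertex : ∀ {n m} → UGraph n m → Dart m → Fin n
dartVertex H (e , false) = UGraph.end₀ H e
dartVertex H (e , true)  = UGraph.end₁ H e

record RotationSystem {n m : ℕ} (H : UGraph n m) : Set where
  field
    σ σ⁻       : Dart m → Dart m
    σσ⁻        : ∀ x → σ (σ⁻ x) ≡ x
    σ⁻σ        : ∀ x → σ⁻ (σ x) ≡ x
    σ-vertex   : ∀ x → dartVertex H (σ x) ≡ dartVertex H x
    σ-cyclic   : ∀ x y → dartVertex H x ≡ dartVertex H y → SameOrbit σ x y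

-- genus-0 condition (Euler's formula per component of the map):
-- #vertex-orbits + #face-orbits = #edges + 2 · #components
IsPlanarRotation : ∀ {n m} (H : UGraph n m) → RotationSystem H → Set
IsPlanarRotation {n} {m} H ρ =
  ∃ λ nV → ∃ λ nF → ∃ λ nC →
    HasClasses (SameOrbit σ) nV ×
    HasClasses (SameOrbit (σ ∘ flipDart)) nF ×
    HasClasses (Orbit₂ σ flipDart) nC ×
    nV ℕ.+ nF ≡ m ℕ.+ 2 ℕ.* nC
  where open RotationSystem ρ

Planar : ∀ {n m} → UGraph n m → Set
Planar H = Σ (RotationSystem H) (IsPlanarRotation H)

record Network (n m : ℕ) : Set where
  field
    tail head : Fin m → Fin n
    l u       : Fin m → ℕ
    S T       : Fin n → Bool
    d         : Fin n → ℤ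
    cV        : Fin n → Maybe ℕ       -- nothing = ∞
    cE        : Fin m → Maybe ℕ

  dsum : (Fin n → Bool) → ℤ
  dsum P = ∑ λ x → mask (P x) (d x)

  underlying : UGraph n m
  underlying = record { end₀ = tail ; end₁ = head }

open Network public

FiniteCostOK : Maybe ℕ → Set
FiniteCostOK nothing  = ⊤
FiniteCostOK (just k) = 1 ℕ.≤ k

record IsInterdictionNetwork {n m : ℕ} (G : Network n m) : Set where
  field
    l≤u       : ∀ e → l G e ℕ.≤ u G e
    disjoint  : ∀ v → S G v ≡ true → T G v ≡ false
    d-source  : ∀ v → S G v ≡ true → d G v ℤ.< 0ℤ
    d-sink    : ∀ v → T G v ≡ true → 0ℤ ℤ.< d G v
    d-other   : ∀ v → S G v ≡ false → T G v ≡ false → d G v ≡ 0ℤ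
    cV-pos    : ∀ v → FiniteCostOK (cV G v)
    cE-pos    : ∀ e → FiniteCostOK (cE G e)
    cV-∞      : ∀ v → S G v ∨ T G v ≡ true → cV G v ≡ nothing

-- The tree 𝒯' : k undirected edges {a i , b i}

data TPath {n k : ℕ} (a b : Fin k → Fin n) (ok : Fin k → Bool) : Fin n → Fin n → Set where
  stay : ∀ {x} → TPath a b ok x x
  fwd  : ∀ i {y} → ok i ≡ true → TPath a b ok (b i) y → TPath a b ok (a i) y
  bwd  : ∀ i {y} → ok i ≡ true → TPath a b ok (a i) y → TPath a b ok (b i) y

allEdges : ∀ {k} → Fin k → Bool
allEdges _ = true

without : ∀ {k} → Fin k → Fin k → Bool
without i j = not (i == j)

record IsSpanningTree {n k : ℕ} (a b : Fin k → Fin n) (W X : Fin n → Bool) : Set where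
  field
    nonempty  : ∃ λ v → W v ≡ true
    a∈W       : ∀ i → W (a i) ≡ true
    b∈W       : ∀ i → W (b i) ≡ true
    X⊆W       : ∀ v → X v ≡ true → W v ≡ true
    connected : ∀ x y → W x ≡ true → W y ≡ true → TPath a b allEdges x y
    acyclic   : ∀ i → ¬ TPath a b (without i) (a i) (b i)

-- endpoint of tree edge i: false ↦ a i (= v), true ↦ b i (= w)
endpt : ∀ {n k} → (Fin k → Fin n) → (Fin k → Fin n) → Fin k → Bool → Fin n
endpt a b i false = a i
endpt a b i true  = b i

-- Vside i β is the set V_{𝒯'}(endpoint β, other endpoint) of vertices
-- connected to endpoint β of edge i in 𝒯' with edge i removed
VsideSpec : ∀ {n k} → (a b : Fin k → Fin n) → (Fin k → Bool → Fin n → Bool) → Set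
VsideSpec {n} {k} a b Vside =
  ∀ i β (x : Fin n) → (Vside i β x ≡ true) ⇔ TPath a b (without i) (endpt a b i β) x

unionGraph : ∀ {n m k} → Network n m → (a b : Fin k → Fin n) → UGraph n (m ℕ.+ k)
unionGraph {m = m} G a b = record
  { end₀ = λ j → [ tail G , a ]′ (splitAt m j)
  ; end₁ = λ j → [ head G , b ]′ (splitAt m j) }

module TreeArcs {n m k : ℕ} (G : Network n m) (a b : Fin k → Fin n)
                (Vside : Fin k → Bool → Fin n → Bool) where
  forward : Fin k → Bool          -- orient {v,w} from v to w ?
  forward i = does (0ℤ ℤ.≤? dsum G (Vside i false))

  tTail tHead : Fin k → Fin n
  tTail i = if forward i then a i else b i
  tHead i = if forward i then b i else a i

  -- l̂ = û = d(V_{𝒯'}(tail, head))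
  tVal : Fin k → ℤ
  tVal i = if forward i then dsum G (Vside i false) else dsum G (Vside i true)

infixl 6 _+∞_
_+∞_ : Maybe ℕ → Maybe ℕ → Maybe ℕ
just x +∞ just y = just (x ℕ.+ y)
_      +∞ _      = nothing

sumM : ∀ {m} → (Fin m → Maybe ℕ) → Maybe ℕ
sumM {zero}  f = just 0
sumM {suc m} f = f zero +∞ sumM (f ∘ suc)

cost : ∀ {n m} → Network n m → (Fin n → Bool) → (Fin m → Bool) → Maybe ℕ
cost G RV RE =
  sumM (λ v → if RV v then cV G v else just 0) +∞
  sumM (λ e → if RE e then cE G e else just 0)

WithinBudget : ∀ {n m} → Network n m → ℕ → (Fin n → Bool) → (Fin m → Bool) → Set
WithinBudget G B RV RE = ∃ λ x → cost G RV RE ≡ just x × x ℕ.≤ B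

alive : ∀ {n m} → Network n m → (Fin n → Bool) → (Fin m → Bool) → Fin m → Bool
alive G RV RE e = not (RE e) ∧ not (RV (tail G e)) ∧ not (RV (head G e))

netOut : ∀ {n m} → Network n m → (Fin n → Bool) → (Fin m → Bool) →
         (Fin m → ℤ) → Fin n → ℤ
netOut G RV RE f v =
  ∑ (λ e → mask (alive G RV RE e ∧ (tail G e == v)) (f e)) ℤ.-
  ∑ (λ e → mask (alive G RV RE e ∧ (head G e == v)) (f e))

SaturatingFlow : ∀ {n m} → Network n m → (Fin n → Bool) → (Fin m → Bool) →
                 (Fin m → ℤ) → Set
SaturatingFlow G RV RE f =
  (∀ e → alive G RV RE e ≡ true → (+ l G e ℤ.≤ f e) × (f e ℤ.≤ + u G e)) ×
  (∀ v → RV v ≡ false → netOut G RV RE f v ≡ ℤ.- d G v)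

-- circulation in Ĝ(R): flow f on the surviving arcs of E and g on the arcs of 𝒯
Circulation : ∀ {n m k} → Network n m → (a b : Fin k → Fin n) →
              (Fin k → Bool → Fin n → Bool) →
              (Fin n → Bool) → (Fin m → Bool) →
              (Fin m → ℤ) → (Fin k → ℤ) → Set
Circulation G a b Vside RV RE f g =
  (∀ e → alive G RV RE e ≡ true → (+ l G e ℤ.≤ f e) × (f e ℤ.≤ + u G e)) ×
  (∀ i → (tVal i ℤ.≤ g i) × (g i ℤ.≤ tVal i)) ×
  (∀ v → netOut G RV RE f v ℤ.+
         (∑ (λ i → mask (tTail i == v) (g i)) ℤ.- ∑ (λ i → mask (tHead i == v) (g i)))
         ≡ 0ℤ)
  where open TreeArcs G a b Vside

-- The tree arcs of Ĝ carry the fixed amount l̂ = û = d(V_𝒯'(v,w)), so a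
-- circulation in Ĝ(R) is a flow f on the surviving arcs of E together with
-- the forced tree flow.  The whole theorem therefore reduces to one identity,
-- the tree balance: at every vertex v the forced tree flow has net outflow
-- exactly d(v).  Given it, conservation of f ⊕ tree-flow at v is the same as
-- "net outflow of f is -d(v)", which is the saturating-flow condition; at an
-- interdicted vertex both sides vanish, since a finite budget never removes a
-- terminal (their cost is ∞) and non-terminals have zero demand.
--
-- The tree balance is proved by counting.  Removing edge i splits the tree
-- into its two sides; for v in the tree call the side not containing v the
-- "far side" of i.  Whichever way i is oriented, its contribution to the net
-- outflow at v is -d(far side).  Every tree vertex x ≠ v lies on the far side
-- of exactly one edge at v (the first edge of the tree path v → x), so the
-- contributions add up to -d(V ∖ {v}) = d(v), using d(V) = 0.

module Submission where

open import Defs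
open import Data.Nat using (ℕ; zero; suc)
open import Data.Integer as ℤ using (ℤ; 0ℤ; _+_; -_; _-_)
import Data.Integer.Properties as ℤP
open import Data.Fin using (Fin; zero; suc; _≟_)
open import Data.Fin.Properties using (suc-injective)
open import Data.Bool using (Bool; true; false; not; if_then_else_; _∨_; _∧_)
open import Data.Bool.Properties using (∧-zeroʳ; ∧-identityʳ; ∨-conicalˡ; ∨-conicalʳ)
open import Data.Maybe using (Maybe; just)
open import Data.Empty using (⊥; ⊥-elim)
open import Data.Product using (Σ; ∃; _×_; _,_; proj₁; proj₂)
open import Data.Sum using (_⊎_; inj₁; inj₂)
open import Function using (_∘_)
open import Function.Bundles using (_⇔_; Equivalence; mk⇔)
open import Relation.Nullary using (¬_; yes; no)
open import Relation.Nullary.Decidable using (dec-true; dec-false)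
open import Relation.Binary.PropositionalEquality
open import Algebra.Properties.AbelianGroup ℤP.+-0-abelianGroup
  using (inverseˡ-unique; inverseʳ-unique)
import Algebra.Properties.CommutativeMonoid.Sum ℤP.+-0-commutativeMonoid as Sum

==-sound : ∀ {n} {x y : Fin n} → (x == y) ≡ true → x ≡ y
==-sound {x = x} {y} e with x ≟ y
... | yes x≡y = x≡y
==-sound () | no _

==-refl : ∀ {n} (x : Fin n) → (x == x) ≡ true
==-refl x = dec-true (x ≟ x) refl

==-false⇒≢ : ∀ {n} {x y : Fin n} → (x == y) ≡ false → x ≢ y
==-false⇒≢ {x = x} x≠x refl with () ← trans (sym (==-refl x)) x≠x

==-≢ : ∀ {n} {x y : Fin n} → x ≢ y → (x == y) ≡ false
==-≢ {x = x} {y} = dec-false (x ≟ y)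

∑≡sum : ∀ {m} (f : Fin m → ℤ) → ∑ f ≡ Sum.sum f
∑≡sum {zero}  f = refl
∑≡sum {suc m} f = cong (f zero +_) (∑≡sum (f ∘ suc))

∑-cong : ∀ {m} {f g : Fin m → ℤ} → (∀ i → f i ≡ g i) → ∑ f ≡ ∑ g
∑-cong {zero}  f≗g = refl
∑-cong {suc m} f≗g = cong₂ _+_ (f≗g zero) (∑-cong (f≗g ∘ suc))

∑-zero : ∀ {m} (f : Fin m → ℤ) → (∀ i → f i ≡ 0ℤ) → ∑ f ≡ 0ℤ
∑-zero {zero}  f f≗0 = refl
∑-zero {suc m} f f≗0 = cong₂ _+_ (f≗0 zero) (∑-zero (f ∘ suc) (f≗0 ∘ suc))

∑-+ : ∀ {m} (f g : Fin m → ℤ) → ∑ (λ i → f i + g i) ≡ ∑ f + ∑ g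
∑-+ {m} f g = begin
  ∑ (λ i → f i + g i)         ≡⟨ ∑≡sum {m} _ ⟩
  Sum.sum (λ i → f i + g i)   ≡⟨ Sum.∑-distrib-+ f g ⟩
  Sum.sum f + Sum.sum g       ≡⟨ sym (cong₂ _+_ (∑≡sum f) (∑≡sum g)) ⟩
  ∑ f + ∑ g                   ∎
  where open ≡-Reasoning

-- negation commutes with ∑ because ∑(-f) + ∑ f = ∑(-f + f) = 0
∑-neg : ∀ {m} (f : Fin m → ℤ) → ∑ (λ i → - f i) ≡ - ∑ f
∑-neg f = inverseˡ-unique _ _
  (trans (sym (∑-+ (λ i → - f i) f)) (∑-zero _ (λ i → ℤP.+-inverseˡ (f i))))

∑-- : ∀ {m} (f g : Fin m → ℤ) → ∑ (λ i → f i - g i) ≡ ∑ f - ∑ g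
∑-- f g = trans (∑-+ f (λ i → - g i)) (cong (∑ f +_) (∑-neg g))

∑-swap : ∀ {m p} (h : Fin m → Fin p → ℤ) →
         ∑ (λ i → ∑ (h i)) ≡ ∑ (λ x → ∑ (λ i → h i x))
∑-swap h = begin
  ∑ (λ i → ∑ (h i))                   ≡⟨ ∑∑≡sumsum h ⟩
  Sum.sum (λ i → Sum.sum (h i))       ≡⟨ Sum.∑-comm h ⟩
  Sum.sum (λ x → Sum.sum (λ i → h i x)) ≡⟨ sym (∑∑≡sumsum (λ x i → h i x)) ⟩
  ∑ (λ x → ∑ (λ i → h i x))           ∎
  where
  open ≡-Reasoning
  ∑∑≡sumsum : ∀ {r s} (h : Fin r → Fin s → ℤ) →
              ∑ (λ i → ∑ (h i)) ≡ Sum.sum (λ i → Sum.sum (h i))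
  ∑∑≡sumsum {r} h = trans (∑-cong (λ i → ∑≡sum (h i))) (∑≡sum {r} _)

∑-mask-none : ∀ {m} (P : Fin m → Bool) (h : Fin m → ℤ) →
              (∀ j → P j ≡ false) → ∑ (λ j → mask (P j) (h j)) ≡ 0ℤ
∑-mask-none P h ¬P = ∑-zero _ (λ j → cong (λ b → mask b (h j)) (¬P j))

∑-mask-unique : ∀ {m} (P : Fin m → Bool) (h : Fin m → ℤ) (i₀ : Fin m) →
                P i₀ ≡ true → (∀ j → P j ≡ true → j ≡ i₀) →
                ∑ (λ j → mask (P j) (h j)) ≡ h i₀
∑-mask-unique P h zero Pi₀ only with P zero
... | true = trans (cong (h zero +_) (∑-mask-none _ _ P≢0)) (ℤP.+-identityʳ _)
  where
  P≢0 : ∀ j → P (suc j) ≡ false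
  P≢0 j with P (suc j) in Pj
  ... | true with () ← only (suc j) Pj
  ... | false = refl
∑-mask-unique P h (suc i₀) Pi₀ only with P zero in P0
... | true with () ← only zero P0
... | false = trans (ℤP.+-identityˡ _)
  (∑-mask-unique (P ∘ suc) (h ∘ suc) i₀ Pi₀ (λ j Pj → suc-injective (only (suc j) Pj)))

mask-complement : ∀ b y → mask (not b) y + mask b y ≡ y
mask-complement true  y = ℤP.+-identityˡ y
mask-complement false y = ℤP.+-identityʳ y

module Paths {n k : ℕ} (a b : Fin k → Fin n) where

  Step : Fin k → Fin n → Fin n → Set
  Step i y y' = (a i ≡ y × b i ≡ y') ⊎ (b i ≡ y × a i ≡ y')

  infixr 5 _++_
  _++_ : ∀ {ok x y z} → TPath a b ok x y → TPath a b ok y z → TPath a b ok x z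
  stay        ++ q = q
  fwd i ok p  ++ q = fwd i ok (p ++ q)
  bwd i ok p  ++ q = bwd i ok (p ++ q)

  single : ∀ {ok i y y'} → ok i ≡ true → Step i y y' → TPath a b ok y y'
  single ok (inj₁ (refl , refl)) = fwd _ ok stay
  single ok (inj₂ (refl , refl)) = bwd _ ok stay

  ≡⇒path : ∀ {ok x y} → x ≡ y → TPath a b ok x y
  ≡⇒path refl = stay

  reverse : ∀ {ok x y} → TPath a b ok x y → TPath a b ok y x
  reverse stay         = stay
  reverse (fwd i ok p) = reverse p ++ bwd i ok stay
  reverse (bwd i ok p) = reverse p ++ fwd i ok stay

  walk : ∀ {ok} (Inv : Fin n → Set) →
         (∀ i {y y'} → ok i ≡ true → Step i y y' → Inv y → Inv y') →
         ∀ {x z} → TPath a b ok x z → Inv x → Inv z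
  walk Inv step stay         inv = inv
  walk Inv step (fwd i ok p) inv = walk Inv step p (step i ok (inj₁ (refl , refl)) inv)
  walk Inv step (bwd i ok p) inv = walk Inv step p (step i ok (inj₂ (refl , refl)) inv)

  same-edge : ∀ {i y y' v w} → Step i y y' → Step i v w →
              (y ≡ v × y' ≡ w) ⊎ (y ≡ w × y' ≡ v)
  same-edge (inj₁ (p , q)) (inj₁ (r , s)) = inj₁ (trans (sym p) r , trans (sym q) s)
  same-edge (inj₁ (p , q)) (inj₂ (r , s)) = inj₂ (trans (sym p) s , trans (sym q) r)
  same-edge (inj₂ (p , q)) (inj₁ (r , s)) = inj₂ (trans (sym p) s , trans (sym q) r)
  same-edge (inj₂ (p , q)) (inj₂ (r , s)) = inj₁ (trans (sym p) r , trans (sym q) s)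

module TreeSides {n k : ℕ} (a b : Fin k → Fin n) (W X : Fin n → Bool)
                 (tree : IsSpanningTree a b W X)
                 (Vside : Fin k → Bool → Fin n → Bool) (spec : VsideSpec a b Vside) where
  open Paths a b
  open IsSpanningTree tree

  Avoiding : Fin k → Fin n → Fin n → Set
  Avoiding i = TPath a b (without i)

  no-bypass : ∀ {i y y'} → Step i y y' → ¬ Avoiding i y y'
  no-bypass {i} (inj₁ (refl , refl)) p = acyclic i p
  no-bypass {i} (inj₂ (refl , refl)) p = acyclic i (reverse p)

  avoids : ∀ {i j : Fin k} → i ≢ j → without i j ≡ true
  avoids i≢j rewrite ==-≢ i≢j = refl

  no-self-loop : ∀ i → a i ≢ b i
  no-self-loop i a≡b = acyclic i (≡⇒path a≡b)

  side-a⇒path : ∀ {i x} → Vside i false x ≡ true → Avoiding i (a i) x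
  side-a⇒path {i} {x} = Equivalence.to (spec i false x)

  side-b⇒path : ∀ {i x} → Vside i true x ≡ true → Avoiding i (b i) x
  side-b⇒path {i} {x} = Equivalence.to (spec i true x)

  path⇒side-a : ∀ {i x} → Avoiding i (a i) x → Vside i false x ≡ true
  path⇒side-a {i} {x} = Equivalence.from (spec i false x)

  path⇒side-b : ∀ {i x} → Avoiding i (b i) x → Vside i true x ≡ true
  path⇒side-b {i} {x} = Equivalence.from (spec i true x)

  -- the two sides of an edge are disjoint (else the edge closes a cycle) ...
  sides-disjoint : ∀ i x → Vside i false x ≡ true → Vside i true x ≡ true → ⊥
  sides-disjoint i x x∈A x∈B = acyclic i (side-a⇒path x∈A ++ reverse (side-b⇒path x∈B))

  -- ... and cover the tree: follow a tree path from a i to x; it stays on the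
  -- a-side until it crosses i, after which it stays on the b-side
  sides-cover : ∀ i x → W x ≡ true → (Vside i false x ≡ true) ⊎ (Vside i true x ≡ true)
  sides-cover i x x∈W with walk Side cross (connected (a i) x (a∈W i) x∈W) (inj₁ stay)
    where
    Side : Fin n → Set
    Side y = Avoiding i (a i) y ⊎ Avoiding i (b i) y
    cross : ∀ j {y y'} → allEdges j ≡ true → Step j y y' → Side y → Side y'
    cross j _ st side with i ≟ j
    cross j _ st (inj₁ p) | no i≢j = inj₁ (p ++ single (==-≢ i≢j |> cong not) st)
      where _|>_ : ∀ {A B : Set} → A → (A → B) → B
            x |> f = f x
    cross j _ st (inj₂ p) | no i≢j = inj₂ (p ++ single (cong not (==-≢ i≢j)) st)
    cross j _ (inj₁ (_ , b≡y')) _ | yes refl = inj₂ (≡⇒path b≡y')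
    cross j _ (inj₂ (_ , a≡y')) _ | yes refl = inj₁ (≡⇒path a≡y')
  ... | inj₁ p = inj₁ (path⇒side-a p)
  ... | inj₂ p = inj₂ (path⇒side-b p)

  farSide : Fin n → Fin k → Fin n → Bool
  farSide v i x =
    if a i == v then Vside i true x else (if b i == v then Vside i false x else false)

  Beyond : Fin n → Fin k → Fin n → Set
  Beyond v i x = Σ (Fin n) λ w → Step i v w × Avoiding i w x

  farSide⇒beyond : ∀ v i x → farSide v i x ≡ true → Beyond v i x
  farSide⇒beyond v i x far with a i == v in a≡v
  ... | true = b i , inj₁ (==-sound a≡v , refl) , side-b⇒path far
  ... | false with b i == v in b≡v
  ... | true = a i , inj₂ (==-sound b≡v , refl) , side-a⇒path far
  farSide⇒beyond v i x () | false | false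

  beyond⇒farSide : ∀ v i x → Beyond v i x → farSide v i x ≡ true
  beyond⇒farSide v i x (_ , inj₁ (a≡v , refl) , p) rewrite a≡v | ==-refl v = path⇒side-b p
  beyond⇒farSide v i x (_ , inj₂ (b≡v , refl) , p) with a i == v in a≡v
  ... | true = ⊥-elim (no-self-loop i (trans (==-sound a≡v) (sym b≡v)))
  ... | false rewrite b≡v | ==-refl v = path⇒side-a p

  farSide-irrefl : ∀ v i → farSide v i v ≡ true → ⊥
  farSide-irrefl v i far with farSide⇒beyond v i v far
  ... | _ , st , p = no-bypass st (reverse p)

  -- every tree vertex x ≠ v is beyond some edge at v: walk from v to x and
  -- remember the edge through which the walk last left v
  farSide-exists : ∀ v x → W v ≡ true → W x ≡ true → x ≢ v →
                   Σ (Fin k) λ i → farSide v i x ≡ true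
  farSide-exists v x v∈W x∈W x≢v
    with walk Reached extend (connected v x v∈W x∈W) (inj₁ refl)
    where
    Reached : Fin n → Set
    Reached y = (y ≡ v) ⊎ Σ (Fin k) λ i → Beyond v i y
    extend : ∀ j {y y'} → allEdges j ≡ true → Step j y y' → Reached y → Reached y'
    extend j {y' = y'} _ st r with y' ≟ v
    ... | yes y'≡v = inj₁ y'≡v
    extend j {y' = y'} _ st (inj₁ refl) | no _ = inj₂ (j , y' , st , stay)
    extend j _ st (inj₂ (i , w , sᵢ , p)) | no y'≢v with i ≟ j
    ... | no i≢j = inj₂ (i , w , sᵢ , p ++ single (avoids i≢j) st)
    ... | yes refl with same-edge st sᵢ
    ...   | inj₁ (_ , y'≡w) = inj₂ (i , w , sᵢ , ≡⇒path (sym y'≡w))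
    ...   | inj₂ (_ , y'≡v) = ⊥-elim (y'≢v y'≡v)
  ... | inj₁ x≡v = ⊥-elim (x≢v x≡v)
  ... | inj₂ (i , beyond) = i , beyond⇒farSide v i x beyond

  -- and the edge is unique: if x were beyond two edges i ≠ j at v, the path
  -- v →(j) wⱼ ⇝ x ⇝ wᵢ would bypass i, or the path wⱼ ⇝ x would bypass j
  farSide-unique : ∀ v x i j → farSide v i x ≡ true → farSide v j x ≡ true → j ≡ i
  farSide-unique v x i j farᵢ farⱼ with i ≟ j
  ... | yes i≡j = sym i≡j
  ... | no i≢j with farSide⇒beyond v i x farᵢ | farSide⇒beyond v j x farⱼ
  ... | wᵢ , sᵢ , pᵢ | wⱼ , sⱼ , pⱼ
    with walk Both extend pⱼ (stay , single (avoids i≢j) sⱼ)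
    where
    Both : Fin n → Set
    Both y = Avoiding j wⱼ y × Avoiding i v y
    extend : ∀ l {y y'} → without j l ≡ true → Step l y y' → Both y → Both y'
    extend l okʲ st (fromWⱼ , fromV) with i ≟ l
    ... | no i≢l = fromWⱼ ++ single okʲ st , fromV ++ single (avoids i≢l) st
    ... | yes refl with same-edge st sᵢ
    ...   | inj₁ (y≡v , _) =
            ⊥-elim (no-bypass sⱼ (reverse (subst (Avoiding j wⱼ) y≡v fromWⱼ)))
    ...   | inj₂ (y≡wᵢ , _) = ⊥-elim (no-bypass sᵢ (subst (Avoiding i v) y≡wᵢ fromV))
  ... | _ , fromV = ⊥-elim (no-bypass sᵢ (fromV ++ reverse pᵢ))

module TreeBalance {n m k : ℕ} (G : Network n m) (a b : Fin k → Fin n) (W X : Fin n → Bool)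
                   (tree : IsSpanningTree a b W X)
                   (Vside : Fin k → Bool → Fin n → Bool) (spec : VsideSpec a b Vside)
                   (d-total : ∑ (d G) ≡ 0ℤ)
                   (d-off-tree : ∀ x → W x ≡ false → d G x ≡ 0ℤ) where
  open TreeSides a b W X tree Vside spec
  open IsSpanningTree tree
  open TreeArcs G a b Vside public

  treeOutflow : (Fin k → ℤ) → Fin n → ℤ
  treeOutflow g v =
    ∑ (λ i → mask (tTail i == v) (g i)) - ∑ (λ i → mask (tHead i == v) (g i))

  -- every vertex carrying demand lies on exactly one side of edge i
  side-split : ∀ i x → mask (Vside i false x) (d G x) + mask (Vside i true x) (d G x) ≡ d G x
  side-split i x with Vside i false x in x∈A | Vside i true x in x∈B
  ... | true  | true  = ⊥-elim (sides-disjoint i x x∈A x∈B)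
  ... | true  | false = ℤP.+-identityʳ _
  ... | false | true  = ℤP.+-identityˡ _
  ... | false | false with W x in x∈W
  ...   | false = sym (d-off-tree x x∈W)
  ...   | true with sides-cover i x x∈W
  ...     | inj₁ x∈A' with () ← trans (sym x∈A) x∈A'
  ...     | inj₂ x∈B' with () ← trans (sym x∈B) x∈B'

  opposite-sides : ∀ i → dsum G (Vside i true) ≡ - dsum G (Vside i false)
  opposite-sides i = inverseʳ-unique _ _
    (trans (sym (∑-+ {n} _ _)) (trans (∑-cong (side-split i)) d-total))

  edge-contribution : ∀ v i (fw : Bool) →
    let val = if fw then dsum G (Vside i false) else dsum G (Vside i true) in
    mask ((if fw then a i else b i) == v) val - mask ((if fw then b i else a i) == v) val
      ≡ - dsum G (farSide v i)
  edge-contribution v i true with a i == v in a≡v | b i == v in b≡v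
  ... | true  | true  = ⊥-elim (no-self-loop i (trans (==-sound a≡v) (sym (==-sound b≡v))))
  ... | true  | false =
    trans (ℤP.+-identityʳ _) (trans (sym (ℤP.neg-involutive _)) (cong -_ (sym (opposite-sides i))))
  ... | false | true  = ℤP.+-identityˡ _
  ... | false | false = cong -_ (sym (∑-zero {n} _ (λ _ → refl)))
  edge-contribution v i false with a i == v in a≡v | b i == v in b≡v
  ... | true  | true  = ⊥-elim (no-self-loop i (trans (==-sound a≡v) (sym (==-sound b≡v))))
  ... | true  | false = ℤP.+-identityˡ _
  ... | false | true  = trans (ℤP.+-identityʳ _) (opposite-sides i)
  ... | false | false = cong -_ (sym (∑-zero {n} _ (λ _ → refl)))

  treeOutflow-regrouped : ∀ v →
    treeOutflow tVal v ≡ - ∑ (λ x → ∑ (λ i → mask (farSide v i x) (d G x)))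
  treeOutflow-regrouped v = begin
    treeOutflow tVal v
      ≡⟨ sym (∑-- {k} _ _) ⟩
    ∑ (λ i → mask (tTail i == v) (tVal i) - mask (tHead i == v) (tVal i))
      ≡⟨ ∑-cong (λ i → edge-contribution v i (forward i)) ⟩
    ∑ (λ i → - dsum G (farSide v i))
      ≡⟨ ∑-neg {k} _ ⟩
    - ∑ (λ i → dsum G (farSide v i))
      ≡⟨ cong -_ (∑-swap {k} {n} _) ⟩
    - ∑ (λ x → ∑ (λ i → mask (farSide v i x) (d G x)))  ∎
    where open ≡-Reasoning

  far-count : ∀ v x → W v ≡ true →
              ∑ (λ i → mask (farSide v i x) (d G x)) ≡ mask (not (x == v)) (d G x)
  far-count v x v∈W with x == v in x≡v
  ... | true = ∑-mask-none {k} _ _ never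
    where
    never : ∀ i → farSide v i x ≡ false
    never i with farSide v i x in far
    ... | true  = ⊥-elim (farSide-irrefl v i (subst (λ y → farSide v i y ≡ true) (==-sound x≡v) far))
    ... | false = refl
  ... | false with W x in x∈W
  ...   | false rewrite d-off-tree x x∈W = ∑-zero {k} _ (λ i → mask-zero (farSide v i x))
    where
    mask-zero : ∀ c → mask c 0ℤ ≡ 0ℤ
    mask-zero true  = refl
    mask-zero false = refl
  ...   | true with farSide-exists v x v∈W x∈W (==-false⇒≢ x≡v)
  ...     | i₀ , far = ∑-mask-unique (λ i → farSide v i x) (λ _ → d G x) i₀ far
                         (λ j farⱼ → farSide-unique v x i₀ j far farⱼ)

  demand-elsewhere : ∀ v → ∑ (λ x → mask (not (x == v)) (d G x)) ≡ - d G v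
  demand-elsewhere v = begin
    ∑ (λ x → mask (not (x == v)) (d G x))
      ≡⟨ inverseˡ-unique _ _ (trans (sym (∑-+ {n} _ _))
                             (trans (∑-cong (λ x → mask-complement (x == v) (d G x))) d-total)) ⟩
    - ∑ (λ x → mask (x == v) (d G x))
      ≡⟨ cong -_ (∑-mask-unique (_== v) (d G) v (==-refl v) (λ _ → ==-sound)) ⟩
    - d G v  ∎
    where open ≡-Reasoning

  farSide-off-tree : ∀ v i x → W v ≡ false → farSide v i x ≡ false
  farSide-off-tree v i x v∉W with a i == v in a≡v | b i == v in b≡v
  ... | true  | _ with () ← trans (sym (a∈W i)) (trans (cong W (==-sound a≡v)) v∉W)
  ... | false | true with () ← trans (sym (b∈W i)) (trans (cong W (==-sound b≡v)) v∉W)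
  ... | false | false = refl

  tree-balance : ∀ v → treeOutflow tVal v ≡ d G v
  tree-balance v with W v in v∈W
  ... | true = begin
    treeOutflow tVal v                                    ≡⟨ treeOutflow-regrouped v ⟩
    - ∑ (λ x → ∑ (λ i → mask (farSide v i x) (d G x)))   ≡⟨ cong -_ (∑-cong (λ x → far-count v x v∈W)) ⟩
    - ∑ (λ x → mask (not (x == v)) (d G x))               ≡⟨ cong -_ (demand-elsewhere v) ⟩
    - - d G v                                             ≡⟨ ℤP.neg-involutive _ ⟩
    d G v                                                 ∎
    where open ≡-Reasoning
  ... | false = begin
    treeOutflow tVal v                                    ≡⟨ treeOutflow-regrouped v ⟩
    - ∑ (λ x → ∑ (λ i → mask (farSide v i x) (d G x)))
      ≡⟨ cong -_ (∑-zero {n} _ (λ x → ∑-mask-none {k} _ _ (λ i → farSide-off-tree v i x v∈W))) ⟩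
    0ℤ                                                    ≡⟨ sym (d-off-tree v v∈W) ⟩
    d G v                                                 ∎
    where open ≡-Reasoning

+∞-finiteˡ : ∀ {p q x} → p +∞ q ≡ just x → ∃ λ y → p ≡ just y
+∞-finiteˡ {just p} {just q} _ = p , refl

+∞-finiteʳ : ∀ {p q x} → p +∞ q ≡ just x → ∃ λ y → q ≡ just y
+∞-finiteʳ {just p} {just q} _ = q , refl

sumM-finite : ∀ {m} (f : Fin m → Maybe ℕ) {y} → sumM f ≡ just y → ∀ i → ∃ λ z → f i ≡ just z
sumM-finite f fin zero    = +∞-finiteˡ {f zero} fin
sumM-finite f fin (suc i) = sumM-finite (f ∘ suc) (proj₂ (+∞-finiteʳ {f zero} fin)) i

module Removal {n m : ℕ} (G : Network n m) (RV : Fin n → Bool) (RE : Fin m → Bool) where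

  dead-tail : ∀ e → RV (tail G e) ≡ true → alive G RV RE e ≡ false
  dead-tail e removed rewrite removed = ∧-zeroʳ (not (RE e))

  dead-head : ∀ e → RV (head G e) ≡ true → alive G RV RE e ≡ false
  dead-head e removed rewrite removed | ∧-zeroʳ (not (RV (tail G e))) = ∧-zeroʳ (not (RE e))

  leaving-dead : ∀ v → RV v ≡ true → ∀ e → (alive G RV RE e ∧ (tail G e == v)) ≡ false
  leaving-dead v removed e with tail G e == v in t≡v
  ... | true  = trans (∧-identityʳ _) (dead-tail e (trans (cong RV (==-sound t≡v)) removed))
  ... | false = ∧-zeroʳ _

  entering-dead : ∀ v → RV v ≡ true → ∀ e → (alive G RV RE e ∧ (head G e == v)) ≡ false
  entering-dead v removed e with head G e == v in h≡v
  ... | true  = trans (∧-identityʳ _) (dead-head e (trans (cong RV (==-sound h≡v)) removed))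
  ... | false = ∧-zeroʳ _

  netOut-removed : ∀ (f : Fin m → ℤ) v → RV v ≡ true → netOut G RV RE f v ≡ 0ℤ
  netOut-removed f v removed
    rewrite ∑-mask-none {m} _ f (leaving-dead v removed)
          | ∑-mask-none {m} _ f (entering-dead v removed) = refl

module Demand {n m : ℕ} (G : Network n m) (net : IsInterdictionNetwork G) where
  open IsInterdictionNetwork net

  non-terminal-demand : ∀ x → S G x ∨ T G x ≡ false → d G x ≡ 0ℤ
  non-terminal-demand x x∉S∪T = d-other x (∨-conicalˡ _ _ x∉S∪T) (∨-conicalʳ _ _ x∉S∪T)

  terminal-split : ∀ x → d G x ≡ mask (S G x) (d G x) + mask (T G x) (d G x)
  terminal-split x with S G x in x∈S
  ... | true rewrite disjoint x x∈S = sym (ℤP.+-identityʳ _)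
  ... | false with T G x in x∈T
  ...   | true  = sym (ℤP.+-identityˡ _)
  ...   | false = d-other x x∈S x∈T

  total-demand : - dsum G (S G) ≡ dsum G (T G) → ∑ (d G) ≡ 0ℤ
  total-demand balanced = begin
    ∑ (d G)                                ≡⟨ ∑-cong terminal-split ⟩
    ∑ (λ x → mask (S G x) (d G x) + mask (T G x) (d G x))
                                           ≡⟨ ∑-+ {n} _ _ ⟩
    dsum G (S G) + dsum G (T G)            ≡⟨ cong (dsum G (S G) +_) (sym balanced) ⟩
    dsum G (S G) + - dsum G (S G)          ≡⟨ ℤP.+-inverseʳ (dsum G (S G)) ⟩
    0ℤ                                     ∎
    where open ≡-Reasoning

  demand-outside : ∀ (W : Fin n → Bool) → (∀ x → S G x ∨ T G x ≡ true → W x ≡ true) →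
                   ∀ x → W x ≡ false → d G x ≡ 0ℤ
  demand-outside W S∪T⊆W x x∉W with S G x ∨ T G x in x∈S∪T
  ... | true with () ← trans (sym (S∪T⊆W x x∈S∪T)) x∉W
  ... | false = non-terminal-demand x x∈S∪T

  -- terminals cost ∞, so a set within a finite budget removes none of them
  removed-demand : ∀ {B RV RE} → WithinBudget G B RV RE → ∀ v → RV v ≡ true → d G v ≡ 0ℤ
  removed-demand {RV = RV} (_ , finite , _) v removed
    with sumM-finite (λ v → if RV v then cV G v else just 0) (proj₂ (+∞-finiteˡ finite)) v
  ... | _ , cost-v rewrite removed with S G v ∨ T G v in v∈S∪T
  ...   | true with () ← trans (sym cost-v) (cV-∞ v v∈S∪T)
  ...   | false = non-terminal-demand v v∈S∪T

module Reduction {n m k : ℕ} (G : Network n m) (net : IsInterdictionNetwork G)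
                 (balanced : - dsum G (S G) ≡ dsum G (T G))
                 (a b : Fin k → Fin n) (W : Fin n → Bool)
                 (tree : IsSpanningTree a b W (λ v → S G v ∨ T G v))
                 (Vside : Fin k → Bool → Fin n → Bool) (spec : VsideSpec a b Vside)
                 {B : ℕ} {RV : Fin n → Bool} {RE : Fin m → Bool}
                 (budget : WithinBudget G B RV RE) where
  open Demand G net
  open Removal G RV RE
  open TreeBalance G a b W _ tree Vside spec (total-demand balanced)
                   (demand-outside W (IsSpanningTree.X⊆W tree))

  saturating⇒circulation : (∃ λ f → SaturatingFlow G RV RE f) →
                           (∃ λ f → ∃ λ g → Circulation G a b Vside RV RE f g)
  saturating⇒circulation (f , bounds , conserve) =
    f , tVal , bounds , (λ i → ℤP.≤-refl , ℤP.≤-refl) ,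
    λ v → trans (cong (netOut G RV RE f v +_) (tree-balance v)) (cancels v)
    where
    cancels : ∀ v → netOut G RV RE f v + d G v ≡ 0ℤ
    cancels v with RV v in removed
    ... | false = trans (cong (_+ d G v) (conserve v removed)) (ℤP.+-inverseˡ (d G v))
    ... | true  = cong₂ _+_ (netOut-removed f v removed) (removed-demand budget v removed)

  circulation⇒saturating : (∃ λ f → ∃ λ g → Circulation G a b Vside RV RE f g) →
                           (∃ λ f → SaturatingFlow G RV RE f)
  circulation⇒saturating (f , g , bounds , g-fixed , conserve) =
    f , bounds ,
    λ v _ → inverseˡ-unique _ _ (trans (cong (netOut G RV RE f v +_) (tree-flow v)) (conserve v))
    where
    -- l̂ = û forces g = tVal, whose outflow is d(v) by the tree balance
    g-forced : ∀ i → g i ≡ tVal i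
    g-forced i = ℤP.≤-antisym (proj₂ (g-fixed i)) (proj₁ (g-fixed i))

    tree-flow : ∀ v → d G v ≡ treeOutflow g v
    tree-flow v = trans (sym (tree-balance v)) (sym (cong₂ _-_
      (∑-cong (λ i → cong (mask (tTail i == v)) (g-forced i)))
      (∑-cong (λ i → cong (mask (tHead i == v)) (g-forced i)))))

theorem7 : ∀ {n m k : ℕ} (G : Network n m) → IsInterdictionNetwork G →
    Planar (underlying G) →
    ℤ.- dsum G (S G) ≡ dsum G (T G) →
    (a b : Fin k → Fin n) (W : Fin n → Bool) →
    IsSpanningTree a b W (λ v → S G v ∨ T G v) →
    Planar (unionGraph G a b) →
    (Vside : Fin k → Bool → Fin n → Bool) → VsideSpec a b Vside →
    (B : ℕ) (RV : Fin n → Bool) (RE : Fin m → Bool) → WithinBudget G B RV RE →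
    (∃ λ f → SaturatingFlow G RV RE f) ⇔
    (∃ λ f → ∃ λ g → Circulation G a b Vside RV RE f g)
theorem7 G net _ balanced a b W tree _ Vside spec B RV RE budget =
  mk⇔ saturating⇒circulation circulation⇒saturating
  where open Reduction G net balanced a b W tree Vside spec budget
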